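{- For every weakly connected digraph $D$ with $n>2$ nodes, the burning number of $D$ is at most $n-1$, and this bound is sharp: for every $n>2$ there is a weakly connected digraph with $n$ nodes whose burning number is $n-1$.
   Context: Burning process on a digraph $D$: a sequence $(x_1,\ldots,x_b)$ of nodes is a burning sequence for $D$ if after $b$ steps of the following process every node of $D$ is burned. In the $i$-th step, first all out-neighbours of all currently burned nodes become burned, and then the node $x_i$ is burned (so after step 1 only $x_1$ is burned). The burning number of $D$ is the length of a shortest burning sequence for $D$. -}

module Defs where

open import Data.Nat using (ℕ; zero; suc; _<_; _≤_)
open import Data.Fin using (Fin; fromℕ<)
open import Data.Vec using (Vec; lookup)
open import Data.Product using (Σ; _×_; ∃-syntax)
open import Data.Sum using (_⊎_)
open import Data.Empty using (⊥)
open import Relation.Nullary using (¬_)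
open import Relation.Binary.PropositionalEquality using (_≡_)
open import Relation.Binary.Construct.Closure.ReflexiveTransitive using (Star)

record Digraph (n : ℕ) : Set₁ where
  field
    Arc      : Fin n → Fin n → Set
    loopless : ∀ v → ¬ Arc v v
open Digraph public

UArc : ∀ {n} → Digraph n → Fin n → Fin n → Set
UArc D u v = Arc D u v ⊎ Arc D v u

WeaklyConnected : ∀ {n} → Digraph n → Set
WeaklyConnected D = ∀ u v → Star (UArc D) u v

-- Burned D xs i i≤b v : node v is burned after step i of the burning process
-- driven by the sequence xs = (x_1,...,x_b).  In step i (1 ≤ i ≤ b), first all
-- out-neighbours of currently burned nodes become burned, then x_i is burned.
Burned : ∀ {n b} → Digraph n → Vec (Fin n) b → (i : ℕ) → i ≤ b → Fin n → Set
Burned D xs zero    _   v = ⊥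
Burned D xs (suc i) si≤b v =
  Burned D xs i (Data.Nat.Properties.<⇒≤ si≤b) v
  ⊎ (∃[ u ] (Burned D xs i (Data.Nat.Properties.<⇒≤ si≤b) u × Arc D u v))
  ⊎ v ≡ lookup xs (fromℕ< si≤b)
  where import Data.Nat.Properties

IsBurningSequence : ∀ {n b} → Digraph n → Vec (Fin n) b → Set
IsBurningSequence {b = b} D xs = ∀ v → Burned D xs b Data.Nat.Properties.≤-refl v
  where import Data.Nat.Properties

HasBurningSequenceOfLength : ∀ {n} → Digraph n → ℕ → Set
HasBurningSequenceOfLength D b = Σ (Vec (Fin _) b) (IsBurningSequence D)

BurningNumber : ∀ {n} → Digraph n → ℕ → Set
BurningNumber D k =
  HasBurningSequenceOfLength D k × (∀ b → b < k → ¬ HasBurningSequenceOfLength D b)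

module Submission where

-- Upper bound: a weakly connected digraph on n ≥ 3 nodes has an arc a → c.
-- Burn a first and then every node other than a and c, one per step; c catches
-- fire from a in step 2, so n − 1 steps suffice.
-- Sharpness: in the in-star whose n − 1 leaves all point to the centre, a leaf has
-- no in-arcs, so it burns only when it is itself chosen; a burning sequence must
-- therefore list all n − 1 leaves.

open import Defs
open import Data.Nat using (ℕ; _+_; _<_; _≤_; _∸_; zero; suc; z≤n; s≤s; _≤′_; ≤′-refl; ≤′-step)
open import Data.Nat.Properties using (≤-irrelevant; <⇒≤; ≤⇒≤′; ≤-refl; <⇒≱; ≮⇒≥)
open import Data.Fin using (Fin; zero; suc; toℕ; fromℕ<; punchIn; punchOut; _≟_)
open import Data.Fin.Properties using (toℕ<n; fromℕ<-toℕ; punchIn-punchOut; suc-injective; injective⇒≤)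
open import Data.Fin.Permutation.Components using (transpose; transpose-inverse)
open import Data.Vec using (Vec; lookup; tabulate)
open import Data.Vec.Properties using (lookup∘tabulate)
open import Data.Product using (_×_; Σ; ∃₂; _,_; proj₁; proj₂)
open import Data.Sum using (inj₁; inj₂)
open import Data.Empty using (⊥; ⊥-elim)
open import Data.Unit using (⊤; tt)
open import Function.Definitions using (Injective)
open import Relation.Nullary using (¬_; yes; no)
open import Relation.Binary.PropositionalEquality using (_≡_; _≢_; refl; sym; trans; cong; subst; module ≡-Reasoning)
open import Relation.Binary.Construct.Closure.ReflexiveTransitive using (Star; ε; _◅_; _◅◅_)

module _ {n b : ℕ} (D : Digraph n) (xs : Vec (Fin n) b) where

  Burned-irrelevant : ∀ {i} (p q : i ≤ b) {v} → Burned D xs i p v → Burned D xs i q v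
  Burned-irrelevant p q burned rewrite ≤-irrelevant p q = burned

  Burned-mono′ : ∀ {i j} (p : i ≤ b) (q : j ≤ b) → i ≤′ j →
                 ∀ {v} → Burned D xs i p v → Burned D xs j q v
  Burned-mono′ p q ≤′-refl       burned = Burned-irrelevant p q burned
  Burned-mono′ p q (≤′-step i≤j) burned = inj₁ (Burned-mono′ p (<⇒≤ q) i≤j burned)

  Burned-mono : ∀ {i j} (p : i ≤ b) (q : j ≤ b) → i ≤ j →
                ∀ {v} → Burned D xs i p v → Burned D xs j q v
  Burned-mono p q i≤j = Burned-mono′ p q (≤⇒≤′ i≤j)

  lookup-burnedAtEnd : (t : Fin b) → Burned D xs b ≤-refl (lookup xs t)
  lookup-burnedAtEnd t =
    Burned-mono (toℕ<n t) ≤-refl (toℕ<n t)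
      (inj₂ (inj₂ (cong (lookup xs) (sym (fromℕ<-toℕ t (toℕ<n t))))))

  source-burned⇒listed : ∀ {v} → (∀ u → ¬ Arc D u v) →
                         ∀ i (p : i ≤ b) → Burned D xs i p v → Σ (Fin b) (λ t → lookup xs t ≡ v)
  source-burned⇒listed noIn (suc i) p (inj₁ burned)              = source-burned⇒listed noIn i _ burned
  source-burned⇒listed noIn (suc i) p (inj₂ (inj₁ (u , _ , arc))) with () ← noIn u arc
  source-burned⇒listed noIn (suc i) p (inj₂ (inj₂ v≡x))           = fromℕ< p , sym v≡x

burningNumber≤length : ∀ {n k b} {D : Digraph n} →
                       BurningNumber D k → HasBurningSequenceOfLength D b → k ≤ b
burningNumber≤length (_ , minimal) seq = ≮⇒≥ (λ b<k → minimal _ b<k seq)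

sources≤length : ∀ {n s b} (D : Digraph n) (f : Fin s → Fin n) → Injective _≡_ _≡_ f →
                 (∀ j u → ¬ Arc D u (f j)) → HasBurningSequenceOfLength D b → s ≤ b
sources≤length {b = b} D f f-injective noIn (xs , burnsAll) = injective⇒≤ position-injective
  where
  listed : ∀ j → Σ (Fin b) (λ t → lookup xs t ≡ f j)
  listed j = source-burned⇒listed D xs (noIn j) b ≤-refl (burnsAll (f j))

  position-injective : Injective _≡_ _≡_ (λ j → proj₁ (listed j))
  position-injective {i} {j} same =
    f-injective (trans (sym (proj₂ (listed i))) (trans (cong (lookup xs) same) (proj₂ (listed j))))

star⇒arc : ∀ {n} {D : Digraph n} {u v} → Star (UArc D) u v → u ≢ v → ∃₂ (Arc D)
star⇒arc ε              u≢u = ⊥-elim (u≢u refl)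
star⇒arc (inj₁ arc ◅ _) _   = _ , _ , arc
star⇒arc (inj₂ arc ◅ _) _   = _ , _ , arc

arc⇒burningSequence : ∀ {k} (D : Digraph (3 + k)) {a c} → Arc D a c →
                      HasBurningSequenceOfLength D (2 + k)
arc⇒burningSequence {k} D {a} {c} arc = xs , burnsAll
  where
  open ≡-Reasoning

  c≢a : c ≢ a
  c≢a c≡a = loopless D a (subst (Arc D a) c≡a arc)

  order : Fin (2 + k) → Fin (3 + k)
  order j = punchIn c (transpose zero (punchOut c≢a) j)

  xs : Vec (Fin (3 + k)) (2 + k)
  xs = tabulate order

  listed : ∀ {w} → c ≢ w → Σ (Fin (2 + k)) (λ t → lookup xs t ≡ w)
  listed {w} c≢w = t , (begin
    lookup xs t                                                     ≡⟨ lookup∘tabulate order t ⟩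
    punchIn c (transpose zero p (transpose p zero (punchOut c≢w)))  ≡⟨ cong (punchIn c) (transpose-inverse zero p) ⟩
    punchIn c (punchOut c≢w)                                        ≡⟨ punchIn-punchOut c≢w ⟩
    w                                                               ∎)
    where
    p = punchOut c≢a
    t = transpose p zero (punchOut c≢w)

  burnsAll : IsBurningSequence D xs
  burnsAll w with c ≟ w
  ... | yes refl = Burned-mono D xs (s≤s (s≤s z≤n)) ≤-refl (s≤s (s≤s z≤n)) c-burnedAt2
    where
    a-burnedAt1 : (p : 1 ≤ 2 + k) → Burned D xs 1 p a
    a-burnedAt1 (s≤s z≤n) = inj₂ (inj₂ (sym (punchIn-punchOut c≢a)))
    c-burnedAt2 : Burned D xs 2 (s≤s (s≤s z≤n)) c
    c-burnedAt2 = inj₂ (inj₁ (a , a-burnedAt1 (<⇒≤ (s≤s (s≤s z≤n))) , arc))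
  ... | no c≢w with listed c≢w
  ...   | t , xs[t]≡w = subst (Burned D xs (2 + k) ≤-refl) xs[t]≡w (lookup-burnedAtEnd D xs t)

InStarArc : ∀ {n} → Fin n → Fin n → Set
InStarArc (suc _) zero = ⊤
InStarArc _       _    = ⊥

inStar : (n : ℕ) → Digraph n
inStar n = record { Arc = InStarArc ; loopless = λ { zero () ; (suc _) () } }

inStar-weaklyConnected : ∀ n → WeaklyConnected (inStar (suc n))
inStar-weaklyConnected n u v = toCentre u ◅◅ fromCentre v
  where
  toCentre : ∀ u → Star (UArc (inStar (suc n))) u zero
  toCentre zero    = ε
  toCentre (suc _) = inj₁ tt ◅ ε
  fromCentre : ∀ v → Star (UArc (inStar (suc n))) zero v
  fromCentre zero    = ε
  fromCentre (suc _) = inj₂ tt ◅ ε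

inStar-leafSource : ∀ {n} (j : Fin n) u → ¬ Arc (inStar (suc n)) u (suc j)
inStar-leafSource j zero    ()
inStar-leafSource j (suc _) ()

mainTheorem2 : ((n : ℕ) → 2 < n → (D : Digraph n) → WeaklyConnected D →
    (k : ℕ) → BurningNumber D k → k ≤ n ∸ 1)
    × ((n : ℕ) → 2 < n →
    Σ (Digraph n) (λ D → WeaklyConnected D × BurningNumber D (n ∸ 1)))
mainTheorem2 = upperBound , sharpness
  where
  upperBound : (n : ℕ) → 2 < n → (D : Digraph n) → WeaklyConnected D →
               (k : ℕ) → BurningNumber D k → k ≤ n ∸ 1
  upperBound _ (s≤s (s≤s (s≤s z≤n))) D connected k bn
    with _ , _ , arc ← star⇒arc {D = D} (connected zero (suc zero)) (λ ())
    = burningNumber≤length bn (arc⇒burningSequence D arc)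

  sharpness : (n : ℕ) → 2 < n → Σ (Digraph n) (λ D → WeaklyConnected D × BurningNumber D (n ∸ 1))
  sharpness _ (s≤s (s≤s (s≤s {n = k} z≤n))) =
    inStar (3 + k) , inStar-weaklyConnected (2 + k) , seq ,
    λ b b<n-1 seqᵇ → <⇒≱ b<n-1 (sources≤length (inStar (3 + k)) suc suc-injective inStar-leafSource seqᵇ)
    where
    seq : HasBurningSequenceOfLength (inStar (3 + k)) (2 + k)
    seq = arc⇒burningSequence (inStar (3 + k)) {suc zero} {zero} tt
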